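{- Let $k\ge 2$ and let $T$ be a $k$-triangulation of a convex $n$-gon containing the diagonal $(a,b)$, where $a<b-k-1$. Then $T$ contains the diagonal $(a,b-1)$ or a diagonal of the form $(a',b)$ with $a<a'\le b-k-1$.
   Context: The vertices of the convex $n$-gon are labeled $1,\dots,n$ clockwise; $(a,b)$ with $a<b$ denotes the diagonal joining $a$ and $b$. Two diagonals cross if they intersect in their interiors (for $a<c$, $(a,b)$ and $(c,d)$ cross iff $a<c<b<d$). A $(k+1)$-crossing is a set of $k+1$ pairwise crossing diagonals; a $k$-triangulation is a maximal set of diagonals containing no $(k+1)$-crossing. -}

module Defs where

open import Data.Nat using (ℕ; zero; suc; _+_; _∸_; _≤_; _<_)
open import Data.Bool using (Bool; true; false)
open import Data.Fin using (Fin)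
open import Data.Product using (_×_; ∃; _,_; proj₁; proj₂)
open import Data.Sum using (_⊎_)
open import Relation.Binary.PropositionalEquality using (_≡_; _≢_)
open import Relation.Nullary using (¬_)

-- A diagonal of the convex n-gon with vertices 1..n: a pair (a , b) with
-- 1 ≤ a, a + 2 ≤ b ≤ n, excluding the side (1 , n).
IsDiagonal : ℕ → ℕ × ℕ → Set
IsDiagonal n (a , b) = 1 ≤ a × (a + 2 ≤ b × (b ≤ n × ¬ (a ≡ 1 × b ≡ n)))

Cross : ℕ × ℕ → ℕ × ℕ → Set
Cross (a , b) (c , d) = (a < c × (c < b × b < d)) ⊎ (c < a × (a < d × d < b))

DiagSet : Set
DiagSet = ℕ × ℕ → Bool

_∈D_ : ℕ × ℕ → DiagSet → Set
d ∈D T = T d ≡ true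

HasCrossing : ℕ → (ℕ × ℕ → Set) → Set
HasCrossing m S = ∃ λ (f : Fin m → ℕ × ℕ) →
  ((i : Fin m) → S (f i)) × ((i j : Fin m) → i ≢ j → Cross (f i) (f j))

IsKTriangulation : ℕ → ℕ → DiagSet → Set
IsKTriangulation k n T =
  ((d : ℕ × ℕ) → d ∈D T → IsDiagonal n d)
  × ¬ HasCrossing (suc k) (λ d → d ∈D T)
  × ((d : ℕ × ℕ) → IsDiagonal n d → ¬ (d ∈D T) →
       HasCrossing (suc k) (λ e → e ∈D T ⊎ e ≡ d))

{-# OPTIONS --safe #-}
-- If (a , b − 1) ∉ T, maximality yields a (k+1)-crossing of T ∪ {(a , b − 1)}, and it
-- must use (a , b − 1).  Were no other member of it ending at b, replacing (a , b − 1) by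
-- (a , b) would keep every crossing and produce a (k+1)-crossing inside T; so some member
-- (a′ , b) crosses (a , b − 1), whence a < a′.  Each of the other k members crosses
-- (a′ , b) and so has an endpoint strictly between a′ and b; crossing diagonals share
-- no endpoint, so together with a′ these are k + 1 distinct points of [a′ , b), and
-- a′ ≤ b − k − 1.

module Submission where

open import Defs
open import Data.Nat using (ℕ; suc; _+_; _∸_; _≤_; _<_; _≟_; _≤?_)
open import Data.Nat.Properties
import Data.Bool as Bool
open import Data.Bool using (true)
open import Data.Fin using (Fin; toℕ; fromℕ<)
import Data.Fin.Properties as Fin
open import Data.Product using (_×_; ∃; _,_; proj₁; proj₂)
open import Data.Product.Properties using (≡-dec)
open import Data.Sum using (_⊎_; inj₁; inj₂)
open import Data.Vec.Functional using (updateAt)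
open import Data.Vec.Functional.Properties using (updateAt-updates; updateAt-minimal)
open import Function using (const; _∘_)
open import Function.Definitions using (Injective)
open import Relation.Nullary using (¬_; yes; no; contradiction)
open import Relation.Nullary.Decidable using (¬?; _×-dec_)
open import Relation.Binary.PropositionalEquality

IsDiagonal-shortenʳ : ∀ {n a b} → IsDiagonal n (a , suc b) → a + 2 ≤ b → IsDiagonal n (a , b)
IsDiagonal-shortenʳ (1≤a , _ , b<n , _) a+2≤b =
  1≤a , a+2≤b , <⇒≤ b<n , λ { (_ , b≡n) → <-irrefl b≡n b<n }

Cross-irrefl : ∀ d → ¬ Cross d d
Cross-irrefl (x , y) (inj₁ (x<x , _)) = <-irrefl refl x<x
Cross-irrefl (x , y) (inj₂ (x<x , _)) = <-irrefl refl x<x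

Cross-sym : ∀ {d e} → Cross d e → Cross e d
Cross-sym {_ , _} {_ , _} (inj₁ c) = inj₂ c
Cross-sym {_ , _} {_ , _} (inj₂ c) = inj₁ c

Cross-sucʳ : ∀ {a b} e → Cross (a , b) e → proj₂ e ≢ suc b → Cross (a , suc b) e
Cross-sucʳ (x , y) (inj₁ (a<x , x<b , b<y)) y≢1+b =
  inj₁ (a<x , m<n⇒m<1+n x<b , ≤∧≢⇒< b<y (≢-sym y≢1+b))
Cross-sucʳ (x , y) (inj₂ (x<a , a<y , y<b)) _ =
  inj₂ (x<a , a<y , m<n⇒m<1+n y<b)

Cross-sucʳ-inv : ∀ {a b c} → Cross (a , b) (c , suc b) → a < c × c < b
Cross-sucʳ-inv (inj₁ (a<c , c<b , _)) = a<c , c<b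
Cross-sucʳ-inv {b = b} (inj₂ (_ , _ , 1+b<b)) = contradiction 1+b<b (<-asym (n<1+n b))

Endpoint : ℕ → ℕ × ℕ → Set
Endpoint v (x , y) = v ≡ x ⊎ v ≡ y

Cross⇒endpoints-distinct : ∀ {d e v w} → Cross d e → Endpoint v d → Endpoint w e → v ≢ w
Cross⇒endpoints-distinct {x , y} {x′ , y′} (inj₁ (x<x′ , x′<y , y<y′)) = distinct
  where
  distinct : ∀ {v w} → Endpoint v (x , y) → Endpoint w (x′ , y′) → v ≢ w
  distinct (inj₁ refl) (inj₁ refl) = <⇒≢ x<x′
  distinct (inj₁ refl) (inj₂ refl) = <⇒≢ (<-trans x<x′ (<-trans x′<y y<y′))
  distinct (inj₂ refl) (inj₁ refl) = >⇒≢ x′<y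
  distinct (inj₂ refl) (inj₂ refl) = <⇒≢ y<y′
Cross⇒endpoints-distinct {_ , _} {_ , _} cr@(inj₂ _) v∈d w∈e v≡w =
  Cross⇒endpoints-distinct (Cross-sym cr) w∈e v∈d (sym v≡w)

innerEndpoint : ℕ → ℕ × ℕ → ℕ
innerEndpoint c (x , y) with c ≤? x
... | yes _ = x
... | no  _ = y

innerEndpoint-endpoint : ∀ c d → Endpoint (innerEndpoint c d) d
innerEndpoint-endpoint c (x , y) with c ≤? x
... | yes _ = inj₁ refl
... | no  _ = inj₂ refl

innerEndpoint-self : ∀ c b → innerEndpoint c (c , b) ≡ c
innerEndpoint-self c b with c ≤? c
... | yes _   = refl
... | no  c≰c = contradiction ≤-refl c≰c

innerEndpoint-cross : ∀ {c b} d → Cross d (c , b) → c ≤ innerEndpoint c d × innerEndpoint c d < b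
innerEndpoint-cross {c} (x , y) cr with c ≤? x | cr
... | yes c≤x | inj₁ (x<c , _)       = contradiction c≤x (<⇒≱ x<c)
... | yes c≤x | inj₂ (_ , x<b , _)   = c≤x , x<b
... | no  _   | inj₁ (_ , c<y , y<b) = <⇒≤ c<y , y<b
... | no  c≰x | inj₂ (c<x , _)       = contradiction (<⇒≤ c<x) c≰x

injective-into-interval⇒≤ : ∀ {m c b} (h : Fin m → ℕ) → Injective _≡_ _≡_ h →
  (∀ i → c ≤ h i × h i < b) → m ≤ b ∸ c
injective-into-interval⇒≤ {m} {c} {b} h h-injective h-range = Fin.injective⇒≤ offset-injective
  where
  offset : Fin m → Fin (b ∸ c)
  offset i = fromℕ< (∸-monoˡ-< (proj₂ (h-range i)) (proj₁ (h-range i)))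

  offset-injective : Injective _≡_ _≡_ offset
  offset-injective {i} {j} offset-i≡offset-j =
    h-injective (∸-cancelʳ-≡ (proj₁ (h-range i)) (proj₁ (h-range j)) (begin
      h i ∸ c         ≡⟨ Fin.toℕ-fromℕ< _ ⟨
      toℕ (offset i)  ≡⟨ cong toℕ offset-i≡offset-j ⟩
      toℕ (offset j)  ≡⟨ Fin.toℕ-fromℕ< _ ⟩
      h j ∸ c         ∎))
    where open ≡-Reasoning

PairwiseCrossing : ∀ {m} → (Fin m → ℕ × ℕ) → Set
PairwiseCrossing f = ∀ i j → i ≢ j → Cross (f i) (f j)

PairwiseCrossing⇒size≤span : ∀ {m c b} (f : Fin m → ℕ × ℕ) → PairwiseCrossing f →
  ∀ {j} → f j ≡ (c , b) → c < b → m ≤ b ∸ c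
PairwiseCrossing⇒size≤span {c = c} {b} f crossing {j} fj≡cb c<b =
  injective-into-interval⇒≤ (innerEndpoint c ∘ f) injective range
  where
  injective : Injective _≡_ _≡_ (innerEndpoint c ∘ f)
  injective {i} {i′} eq with i Fin.≟ i′
  ... | yes i≡i′ = i≡i′
  ... | no  i≢i′ = contradiction eq (Cross⇒endpoints-distinct (crossing i i′ i≢i′)
                     (innerEndpoint-endpoint c (f i)) (innerEndpoint-endpoint c (f i′)))

  range : ∀ i → c ≤ innerEndpoint c (f i) × innerEndpoint c (f i) < b
  range i with i Fin.≟ j
  ... | yes refl rewrite fj≡cb | innerEndpoint-self c b = ≤-refl , c<b
  ... | no  i≢j = innerEndpoint-cross (f i) (subst (Cross (f i)) fj≡cb (crossing i j i≢j))

HasCrossing-replace : ∀ {m} {S : ℕ × ℕ → Set} (f : Fin m → ℕ × ℕ) i {d} →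
  PairwiseCrossing f → (∀ j → j ≢ i → S (f j)) → (∀ j → j ≢ i → Cross d (f j)) →
  S d → HasCrossing m S
HasCrossing-replace {m} {S} f i {d} crossing others-in-S d-crosses-others d∈S =
  g , members , g-crossing
  where
  g : Fin m → ℕ × ℕ
  g = updateAt f i (const d)

  g-at : ∀ j → (j ≡ i × g j ≡ d) ⊎ (j ≢ i × g j ≡ f j)
  g-at j with j Fin.≟ i
  ... | yes refl = inj₁ (refl , updateAt-updates i f)
  ... | no  j≢i  = inj₂ (j≢i , updateAt-minimal j i f j≢i)

  members : ∀ j → S (g j)
  members j with g-at j
  ... | inj₁ (_ , gj≡d)  = subst S (sym gj≡d) d∈S
  ... | inj₂ (j≢i , gj≡fj) = subst S (sym gj≡fj) (others-in-S j j≢i)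

  g-crossing : PairwiseCrossing g
  g-crossing j j′ j≢j′ with g-at j | g-at j′
  ... | inj₁ (refl , _) | inj₁ (refl , _) = contradiction refl j≢j′
  ... | inj₁ (_ , gj≡d) | inj₂ (j′≢i , gj′≡fj′) =
    subst₂ Cross (sym gj≡d) (sym gj′≡fj′) (d-crosses-others j′ j′≢i)
  ... | inj₂ (j≢i , gj≡fj) | inj₁ (_ , gj′≡d) =
    subst₂ Cross (sym gj≡fj) (sym gj′≡d) (Cross-sym (d-crosses-others j j≢i))
  ... | inj₂ (_ , gj≡fj) | inj₂ (_ , gj′≡fj′) =
    subst₂ Cross (sym gj≡fj) (sym gj′≡fj′) (crossing j j′ j≢j′)

crossing-with-new-diagonal : ∀ {m} {S : ℕ × ℕ → Set} {d} → ¬ HasCrossing m S →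
  (f : Fin m → ℕ × ℕ) → (∀ i → S (f i) ⊎ f i ≡ d) → PairwiseCrossing f →
  ∃ λ i → f i ≡ d × (∀ j → j ≢ i → S (f j))
crossing-with-new-diagonal {S = S} {d} no-crossing f members crossing
  with Fin.any? (λ i → ≡-dec _≟_ _≟_ (f i) d)
... | no  ∄i = contradiction (f , all-in-S , crossing) no-crossing
  where
  all-in-S : ∀ i → S (f i)
  all-in-S i with members i
  ... | inj₁ fi∈S = fi∈S
  ... | inj₂ fi≡d = contradiction (i , fi≡d) ∄i
... | yes (i , fi≡d) = i , fi≡d , others-in-S
  where
  others-in-S : ∀ j → j ≢ i → S (f j)
  others-in-S j j≢i with members j
  ... | inj₁ fj∈S = fj∈S
  ... | inj₂ fj≡d = contradiction (subst₂ Cross fj≡d fi≡d (crossing j i j≢i)) (Cross-irrefl d)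

crossing-has-member-ending-at-suc : ∀ {m} {S : ℕ × ℕ → Set} {a b} → ¬ HasCrossing m S →
  S (a , suc b) → (f : Fin m → ℕ × ℕ) → PairwiseCrossing f →
  ∀ {i} → f i ≡ (a , b) → (∀ j → j ≢ i → S (f j)) →
  ∃ λ j → j ≢ i × proj₂ (f j) ≡ suc b
crossing-has-member-ending-at-suc {S = S} {b = b}
  no-crossing a1+b∈S f crossing {i} fi≡ab others-in-S
  with Fin.any? (λ j → ¬? (j Fin.≟ i) ×-dec (proj₂ (f j) ≟ suc b))
... | yes found = found
... | no  ∄j    = contradiction
  (HasCrossing-replace {S = S} f i crossing others-in-S a1+b-crosses-others a1+b∈S) no-crossing
  where
  a1+b-crosses-others : ∀ j → j ≢ i → Cross (_ , suc b) (f j)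
  a1+b-crosses-others j j≢i = Cross-sucʳ (f j)
    (subst (λ e → Cross e (f j)) fi≡ab (crossing i j (≢-sym j≢i)))
    (λ fj-ends-at-1+b → ∄j (j , j≢i , fj-ends-at-1+b))

m≤o∸n⇒n≤o∸m : ∀ {m n o} → n ≤ o → m ≤ o ∸ n → n ≤ o ∸ m
m≤o∸n⇒n≤o∸m {m} {n} {o} n≤o m≤o∸n =
  m+n≤o⇒m≤o∸n n (subst (_≤ o) (+-comm m n) (m≤o∸n⇒m+n≤o m n≤o m≤o∸n))

m∸[1+n]≡m∸n∸1 : ∀ m n → m ∸ suc n ≡ m ∸ n ∸ 1
m∸[1+n]≡m∸n∸1 m n = sym (trans (∸-+-assoc m n 1) (cong (m ∸_) (+-comm n 1)))

crossing-with-shortened⇒neighbour : ∀ {m} {S : ℕ × ℕ → Set} {a b} →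
  ¬ HasCrossing (suc m) S → S (a , suc b) → HasCrossing (suc m) (λ e → S e ⊎ e ≡ (a , b)) →
  ∃ λ c → a < c × c ≤ b ∸ m × S (c , suc b)
crossing-with-shortened⇒neighbour {m} {S} {a} {b} no-crossing a1+b∈S (f , members , crossing)
  with crossing-with-new-diagonal {S = S} no-crossing f members crossing
... | i , fi≡ab , others-in-S
  with crossing-has-member-ending-at-suc {S = S} no-crossing a1+b∈S f crossing fi≡ab others-in-S
... | j , j≢i , fj-ends-at-1+b =
  c , a<c , m≤o∸n⇒n≤o∸m (<⇒≤ c<1+b) (PairwiseCrossing⇒size≤span f crossing fj≡c1+b c<1+b) ,
  subst S fj≡c1+b (others-in-S j j≢i)
  where
  c : ℕ
  c = proj₁ (f j)

  fj≡c1+b : f j ≡ (c , suc b)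
  fj≡c1+b = cong (c ,_) fj-ends-at-1+b

  a<c×c<b : a < c × c < b
  a<c×c<b = Cross-sucʳ-inv (subst₂ Cross fi≡ab fj≡c1+b (crossing i j (≢-sym j≢i)))

  a<c : a < c
  a<c = proj₁ a<c×c<b

  c<1+b : c < suc b
  c<1+b = m<n⇒m<1+n (proj₂ a<c×c<b)

lemma6p1 : (k n : ℕ) → 2 ≤ k → (T : DiagSet) → IsKTriangulation k n T →
    (a b : ℕ) → (a , b) ∈D T → a + k + 1 < b →
    ((a , b ∸ 1) ∈D T) ⊎ (∃ λ a′ → a < a′ × a′ ≤ b ∸ k ∸ 1 × (a′ , b) ∈D T)
lemma6p1 k n 2≤k T (diagonal , no-crossing , maximal) a (suc b) a1+b∈T a+k+1<1+b
  with T (a , b) Bool.≟ true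
... | yes ab∈T = inj₁ ab∈T
... | no  ab∉T =
  let c , a<c , c≤b∸k , c1+b∈T = neighbour
  in  inj₂ (c , a<c , subst (c ≤_) (m∸[1+n]≡m∸n∸1 (suc b) k) c≤b∸k , c1+b∈T)
  where
  ab-diagonal : IsDiagonal n (a , b)
  ab-diagonal = IsDiagonal-shortenʳ (diagonal _ a1+b∈T)
    (≤-trans (+-monoʳ-≤ a 2≤k) (≤-trans (m≤m+n (a + k) 1) (≤-pred a+k+1<1+b)))

  neighbour : ∃ λ c → a < c × c ≤ b ∸ k × (c , suc b) ∈D T
  neighbour = crossing-with-shortened⇒neighbour {S = _∈D T} no-crossing a1+b∈T
    (maximal (a , b) ab-diagonal ab∉T)
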